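{- If $\tau$ is a computation type with $\tau\neq_{\mathsf C}\omega_{\mathsf C}$, then there is a value type $\delta$ with $\tau=_{\mathsf C}T\delta$; hence $\tau\le_{\mathsf C}T\omega_{\mathsf V}$.
   Context: Value types $\delta ::= \alpha\mid \delta\to\tau\mid \delta\wedge\delta\mid \omega_{\mathsf V}$ ($\alpha$ type variables), computation types $\tau ::= T\delta\mid \tau\wedge\tau\mid \omega_{\mathsf C}$. The preorders $\le_{\mathsf V},\le_{\mathsf C}$ are the least preorders such that for each sort $\omega$ is the top, $\wedge$ is monotone, idempotent, commutative, $\sigma\wedge\sigma'\le\sigma$, and $\sigma\le\sigma',\sigma\le\sigma''\Rightarrow\sigma\le\sigma'\wedge\sigma''$; and $\omega_{\mathsf V}\le_{\mathsf V}\omega_{\mathsf V}\to\omega_{\mathsf C}$, $(\delta\to\tau)\wedge(\delta\to\tau')\le_{\mathsf V}\delta\to(\tau\wedge\tau')$, $\delta'\le_{\mathsf V}\delta,\tau\le_{\mathsf C}\tau'\Rightarrow\delta\to\tau\le_{\mathsf V}\delta'\to\tau'$, $T\delta\wedge T\delta'\le_{\mathsf C}T(\delta\wedge\delta')$, $\delta\le_{\mathsf V}\delta'\Rightarrow T\delta\le_{\mathsf C}T\delta'$. $=_{\mathsf C}$ is the equivalence $\le_{\mathsf C}\cap\ge_{\mathsf C}$. -}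

module Defs where

open import Data.Nat using (ℕ)
open import Data.Product using (_×_)

mutual
  data VType : Set where
    tvar : ℕ → VType
    _⇒_  : VType → CType → VType
    _∧V_ : VType → VType → VType
    ωV   : VType

  data CType : Set where
    T    : VType → CType
    _∧C_ : CType → CType → CType
    ωC   : CType

infixr 5 _⇒_
infixl 6 _∧V_ _∧C_

mutual
  data _≤V_ : VType → VType → Set where
    reflV   : ∀ {δ} → δ ≤V δ
    transV  : ∀ {δ₁ δ₂ δ₃} → δ₁ ≤V δ₂ → δ₂ ≤V δ₃ → δ₁ ≤V δ₃
    topV    : ∀ {δ} → δ ≤V ωV
    monoV   : ∀ {δ₁ δ₁' δ₂ δ₂'} → δ₁ ≤V δ₁' → δ₂ ≤V δ₂' → (δ₁ ∧V δ₂) ≤V (δ₁' ∧V δ₂')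
    idem₁V  : ∀ {δ} → (δ ∧V δ) ≤V δ
    idem₂V  : ∀ {δ} → δ ≤V (δ ∧V δ)
    commV   : ∀ {δ δ'} → (δ ∧V δ') ≤V (δ' ∧V δ)
    projV   : ∀ {δ δ'} → (δ ∧V δ') ≤V δ
    glbV    : ∀ {δ δ' δ''} → δ ≤V δ' → δ ≤V δ'' → δ ≤V (δ' ∧V δ'')
    ωarrV   : ωV ≤V (ωV ⇒ ωC)
    arrDistV : ∀ {δ τ τ'} → ((δ ⇒ τ) ∧V (δ ⇒ τ')) ≤V (δ ⇒ (τ ∧C τ'))
    arrV    : ∀ {δ δ' τ τ'} → δ' ≤V δ → τ ≤C τ' → (δ ⇒ τ) ≤V (δ' ⇒ τ')

  data _≤C_ : CType → CType → Set where
    reflC   : ∀ {τ} → τ ≤C τ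
    transC  : ∀ {τ₁ τ₂ τ₃} → τ₁ ≤C τ₂ → τ₂ ≤C τ₃ → τ₁ ≤C τ₃
    topC    : ∀ {τ} → τ ≤C ωC
    monoC   : ∀ {τ₁ τ₁' τ₂ τ₂'} → τ₁ ≤C τ₁' → τ₂ ≤C τ₂' → (τ₁ ∧C τ₂) ≤C (τ₁' ∧C τ₂')
    idem₁C  : ∀ {τ} → (τ ∧C τ) ≤C τ
    idem₂C  : ∀ {τ} → τ ≤C (τ ∧C τ)
    commC   : ∀ {τ τ'} → (τ ∧C τ') ≤C (τ' ∧C τ)
    projC   : ∀ {τ τ'} → (τ ∧C τ') ≤C τ
    glbC    : ∀ {τ τ' τ''} → τ ≤C τ' → τ ≤C τ'' → τ ≤C (τ' ∧C τ'')
    TdistC  : ∀ {δ δ'} → (T δ ∧C T δ') ≤C T (δ ∧V δ')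
    TmonoC  : ∀ {δ δ'} → δ ≤V δ' → T δ ≤C T δ'

infix 4 _≤V_ _≤C_ _=C_

_=C_ : CType → CType → Set
τ =C τ' = (τ ≤C τ') × (τ' ≤C τ)

-- Up to =C, a computation type is either ωC or a single T δ: ωC is a unit for ∧C,
-- and T δ ∧C T δ' =C T (δ ∧V δ') since T is monotone and distributes over meets.
-- Induction on τ therefore normalises it to one of these two shapes.
module Submission where

open import Defs
open import Data.Product using (Σ; _×_; _,_)
open import Data.Sum using (_⊎_; inj₁; inj₂)
open import Data.Empty using (⊥-elim)
open import Relation.Nullary using (¬_)

projʳV : ∀ {δ δ'} → δ ∧V δ' ≤V δ'
projʳV = transV commV projV

projʳC : ∀ {τ τ'} → τ ∧C τ' ≤C τ'
projʳC = transC commC projC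

=C-trans : ∀ {τ₁ τ₂ τ₃} → τ₁ =C τ₂ → τ₂ =C τ₃ → τ₁ =C τ₃
=C-trans (p , p') (q , q') = transC p q , transC q' p'

∧C-cong : ∀ {τ₁ τ₁' τ₂ τ₂'} → τ₁ =C τ₁' → τ₂ =C τ₂' → τ₁ ∧C τ₂ =C τ₁' ∧C τ₂'
∧C-cong (p , p') (q , q') = monoC p q , monoC p' q'

∧C-identityˡ : ∀ {τ τ'} → τ =C ωC → τ ∧C τ' =C τ'
∧C-identityˡ (_ , ω≤τ) = projʳC , glbC (transC topC ω≤τ) reflC

∧C-identityʳ : ∀ {τ τ'} → τ' =C ωC → τ ∧C τ' =C τ
∧C-identityʳ (_ , ω≤τ') = projC , glbC reflC (transC topC ω≤τ')

T-∧ : ∀ {δ δ'} → T δ ∧C T δ' =C T (δ ∧V δ')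
T-∧ = TdistC , glbC (TmonoC projV) (TmonoC projʳV)

=ωC⊎=T : (τ : CType) → τ =C ωC ⊎ Σ VType (λ δ → τ =C T δ)
=ωC⊎=T (T δ) = inj₂ (δ , reflC , reflC)
=ωC⊎=T ωC    = inj₁ (reflC , reflC)
=ωC⊎=T (τ₁ ∧C τ₂) with =ωC⊎=T τ₁ | =ωC⊎=T τ₂
... | inj₁ τ₁=ω        | inj₁ τ₂=ω        = inj₁ (=C-trans (∧C-identityˡ τ₁=ω) τ₂=ω)
... | inj₁ τ₁=ω        | inj₂ (δ , τ₂=T)  = inj₂ (δ , =C-trans (∧C-identityˡ τ₁=ω) τ₂=T)
... | inj₂ (δ , τ₁=T)  | inj₁ τ₂=ω        = inj₂ (δ , =C-trans (∧C-identityʳ τ₂=ω) τ₁=T)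
... | inj₂ (δ₁ , τ₁=T) | inj₂ (δ₂ , τ₂=T) = inj₂ (δ₁ ∧V δ₂ , =C-trans (∧C-cong τ₁=T τ₂=T) T-∧)

mainTheorem11 : (τ : CType) → ¬ (τ =C ωC) →
    Σ VType (λ δ → τ =C T δ) × (τ ≤C T ωV)
mainTheorem11 τ τ≠ω with =ωC⊎=T τ
... | inj₁ τ=ω             = ⊥-elim (τ≠ω τ=ω)
... | inj₂ (δ , τ≤T , T≤τ) = (δ , τ≤T , T≤τ) , transC τ≤T (TmonoC topV)
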